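{- Let $\mathcal T$ be an irreducible toric trinity with black triangles forming a set of size $n$, and let $s$ be a state in a cyclic component of the state transition graph of $\mathcal T$. Then there is an ordering $\Delta_1,\dots,\Delta_n$ of all the black triangles of $\mathcal T$ (each appearing exactly once) such that, starting from $s$, one can successively perform the clockwise moves changing $\Delta_1$, then $\Delta_2$, ..., then $\Delta_n$ (each $\Delta_j$ being a clockwise empty black triangle at the moment it is changed), and the state reached at the end is $s$ again.
   Context: A trinity is a triangulation $\mathcal T$ of a compact connected oriented closed surface $\Sigma$ whose vertices are colored red, green, blue so that the endpoints of every edge have different colors. A toric trinity is a trinity on the torus. A triangle is black if its vertices, read clockwise, appear in the cyclic order blue, green, red; otherwise white. A state of a toric trinity is a bijection between white triangles and vertices matching each white triangle with one of its own vertices. Clock moves: for a black triangle $\Delta$ with vertices $u_1,u_2,u_3$ in clockwise order and $W_i$ the white triangle sharing the edge $u_iu_{i+1}$ with $\Delta$ (indices mod 3), $\Delta$ is a clockwise empty black triangle of $s$ if $s$ matches $W_i$ with $u_{i+1}$ for all $i$, and counter-clockwise empty if $s$ matches $W_i$ with $u_i$ for all $i$. The clockwise move changing a clockwise empty $\Delta$ replaces the pairs $(W_i,u_{i+1})$ by $(W_i,u_i)$ and leaves all other pairs unchanged; the counter-clockwise move is its inverse. (In an irreducible trinity every clock move is of this form.) The state transition graph has the states as vertices with a directed edge $s\to t$ when $t$ is obtained from $s$ by a clockwise move; components are those of the underlying undirected graph. A state is recurrent if it can be returned to by a nonempty sequence of clockwise moves; a component is cyclic if it contains a recurrent state. Irreducibility: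 let $\mathcal F$ be the trinity on $S^2$ with three vertices and two triangles. For a trinity $\mathcal T$, a black triangle $\Delta$ of it and a trinity $\mathcal T_0$ on $S^2$ with a chosen (outer) white triangle, the connected sum $\mathcal T\#\mathcal T_0$ is obtained by removing the interior of $\Delta$ and gluing in $\mathcal T_0$ minus the interior of its outer triangle, matching colors on the boundary. It is trivial if $\mathcal T$ or $\mathcal T_0$ is $\mathcal F$. A trinity is irreducible if it is not $\mathcal F$ and is not a nontrivial connected sum. -}

module Defs where

open import Data.Nat using (ℕ; zero; suc; _+_; _≤_)
open import Data.Fin using (Fin)
open import Data.Fin.Permutation using (Permutation′; _⟨$⟩ʳ_; _⟨$⟩ˡ_)
import Data.Fin.Permutation as Perm
open import Data.Product using (Σ; ∃; ∃₂; _×_; _,_; proj₁)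
open import Data.Sum using (_⊎_; inj₁; inj₂)
open import Data.List using (List; []; _∷_)
open import Relation.Nullary using (¬_)
open import Relation.Binary.PropositionalEquality using (_≡_; _≢_)
open import Relation.Binary.Construct.Closure.ReflexiveTransitive using (Star)
open import Relation.Binary.Construct.Closure.Symmetric using (SymClosure)
open import Relation.Binary.Construct.Closure.Transitive using (TransClosure)

-- Colours.  A black triangle reads blue, green, red clockwise.

data Color : Set where
  red green blue : Color

next : Color → Color
next red   = green
next green = blue
next blue  = red

prev : Color → Color
prev red   = blue
prev green = red
prev blue  = green

-- Adjacent triangles always have opposite colours (black/white), and
-- the side of a triangle opposite its k-coloured corner is glued to the
-- side opposite the k-coloured corner of its neighbour.  Hence the
-- numbers of black and white triangles agree (= n), and the whole
-- triangulation is encoded by three permutations: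
--   σ k ⟨$⟩ʳ b = the white triangle glued to black triangle b along the
--               side of b opposite its corner of colour k.
-- Vertices are the equivalence classes of corners (see SameVertex).

record PreTrinity : Set where
  field
    n : ℕ
    σ : Color → Permutation′ n

open PreTrinity public

Black : PreTrinity → Set
Black T = Fin (n T)

White : PreTrinity → Set
White T = Fin (n T)

-- rotation around a vertex of colour k, on the black triangles having it
-- as a corner: b ↦ (σ (prev k))⁻¹ (σ (next k) b)
ρ : (T : PreTrinity) → Color → Black T → Black T
ρ T k b = σ T (prev k) ⟨$⟩ˡ (σ T (next k) ⟨$⟩ʳ b)

iter : {A : Set} → (A → A) → ℕ → A → A
iter f zero    a = a
iter f (suc j) a = f (iter f j a)

SameVertex : (T : PreTrinity) → Color → Black T → Black T → Set
SameVertex T k b b' = ∃ λ j → iter (ρ T k) j b ≡ b'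

-- a vertex is represented by a colour k and a black triangle having it
-- as its k-coloured corner (every vertex has at least one such)
Vertex : PreTrinity → Set
Vertex T = Color × Black T

_≈V_ : {T : PreTrinity} → Vertex T → Vertex T → Set
_≈V_ {T} (k , b) (k' , b') = k ≡ k' × SameVertex T k b b'

-- the black triangle sharing with white w the side opposite colour next k;
-- its k-coloured corner is the k-coloured corner of w
wcorner : (T : PreTrinity) → White T → Color → Black T
wcorner T w k = σ T (next k) ⟨$⟩ˡ w

VertexCount : (T : PreTrinity) → ℕ → Set
VertexCount T V =
  Σ (Fin V → Vertex T) λ f →
    (∀ (v : Vertex T) → ∃ λ i → _≈V_ {T} (f i) v) ×
    (∀ i j → _≈V_ {T} (f i) (f j) → i ≡ j)

Adj : (T : PreTrinity) → Black T → Black T → Set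
Adj T b b' = ∃₂ λ k k' → σ T k ⟨$⟩ʳ b ≡ σ T k' ⟨$⟩ʳ b'

-- the surface is (nonempty and) connected: the trinity condition
Connected : PreTrinity → Set
Connected T = 1 ≤ n T × (∀ b b' → Star (Adj T) b b')

-- Euler characteristic V - E + F = V - 3n + 2n = V - n
Spherical : PreTrinity → Set
Spherical T = Connected T × VertexCount T (2 + n T)

Toric : PreTrinity → Set
Toric T = Connected T × VertexCount T (n T)

Iso : PreTrinity → PreTrinity → Set
Iso T T' = Σ (n T ≡ n T') λ _ →
  Σ (Fin (n T) → Fin (n T')) λ α → Σ (Fin (n T) → Fin (n T')) λ β →
    (∀ x y → α x ≡ α y → x ≡ y) × (∀ y → ∃ λ x → α x ≡ y) ×
    (∀ x y → β x ≡ β y → x ≡ y) × (∀ y → ∃ λ x → β x ≡ y) ×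
    (∀ k b → β (σ T k ⟨$⟩ʳ b) ≡ σ T' k ⟨$⟩ʳ (α b))

-- F : three vertices, one black and one white triangle (on S²)
𝓕 : PreTrinity
𝓕 = record { n = 1 ; σ = λ _ → Perm.id }

IsF : PreTrinity → Set
IsF T = Iso T 𝓕

-- R is the connected sum T # T0, where Δ is a black triangle of T and o
-- the outer white triangle of T0.  Black triangles of R correspond
-- bijectively (via α) to (blacks of T except Δ) ⊎ (blacks of T0), white
-- triangles of R (via β) to (whites of T) ⊎ (whites of T0 except o), and
-- the gluing is inherited, the sides of o being replaced by those of Δ.
IsConnSum : (R T : PreTrinity) → Black T → (T0 : PreTrinity) → White T0 → Set
IsConnSum R T Δ T0 o =
  Σ (Black R → Black T ⊎ Black T0) λ α →
  Σ (White R → White T ⊎ White T0) λ β →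
    (∀ x y → α x ≡ α y → x ≡ y) ×
    (∀ y → y ≢ inj₁ Δ → ∃ λ x → α x ≡ y) ×
    (∀ x → α x ≢ inj₁ Δ) ×
    (∀ x y → β x ≡ β y → x ≡ y) ×
    (∀ y → y ≢ inj₂ o → ∃ λ x → β x ≡ y) ×
    (∀ x → β x ≢ inj₂ o) ×
    (∀ k x b → α x ≡ inj₁ b → β (σ R k ⟨$⟩ʳ x) ≡ inj₁ (σ T k ⟨$⟩ʳ b)) ×
    (∀ k x c → α x ≡ inj₂ c → σ T0 k ⟨$⟩ʳ c ≡ o →
       β (σ R k ⟨$⟩ʳ x) ≡ inj₁ (σ T k ⟨$⟩ʳ Δ)) ×
    (∀ k x c → α x ≡ inj₂ c → σ T0 k ⟨$⟩ʳ c ≢ o →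
       β (σ R k ⟨$⟩ʳ x) ≡ inj₂ (σ T0 k ⟨$⟩ʳ c))

NontrivialConnSum : PreTrinity → Set
NontrivialConnSum R =
  Σ PreTrinity λ T → Σ (Black T) λ Δ → Σ PreTrinity λ T0 → Σ (White T0) λ o →
    Connected T × Spherical T0 × IsConnSum R T Δ T0 o × ¬ IsF T × ¬ IsF T0

Irreducible : PreTrinity → Set
Irreducible T = ¬ IsF T × ¬ NontrivialConnSum T

-- States: a state assigns to each white triangle w the colour of the
-- corner of w it is matched with; the induced map whites → vertices
-- must be a bijection.

IsState : (T : PreTrinity) → (White T → Color) → Set
IsState T s =
  ∀ (k : Color) (b : Black T) →
    Σ (White T) λ w → (s w ≡ k × SameVertex T k (wcorner T w k) b) ×
      (∀ w' → s w' ≡ k → SameVertex T k (wcorner T w' k) b → w' ≡ w)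

State : PreTrinity → Set
State T = Σ (White T → Color) (IsState T)

-- Black Δ with clockwise vertices u1,u2,u3 = blue, green, red corners;
-- W1 = σ red Δ (edge u1u2), W2 = σ blue Δ (edge u2u3), W3 = σ green Δ
-- (edge u3u1).  Clockwise empty: W1 ↦ u2, W2 ↦ u3, W3 ↦ u1.
ClockwiseEmpty : (T : PreTrinity) → Black T → State T → Set
ClockwiseEmpty T Δ (s , _) =
  s (σ T red ⟨$⟩ʳ Δ) ≡ green × s (σ T blue ⟨$⟩ʳ Δ) ≡ red ×
  s (σ T green ⟨$⟩ʳ Δ) ≡ blue

MoveBy : (T : PreTrinity) → Black T → State T → State T → Set
MoveBy T Δ s t =
  ClockwiseEmpty T Δ s ×
  proj₁ t (σ T red ⟨$⟩ʳ Δ) ≡ blue × proj₁ t (σ T blue ⟨$⟩ʳ Δ) ≡ green ×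
  proj₁ t (σ T green ⟨$⟩ʳ Δ) ≡ red ×
  (∀ w → w ≢ σ T red ⟨$⟩ʳ Δ → w ≢ σ T blue ⟨$⟩ʳ Δ → w ≢ σ T green ⟨$⟩ʳ Δ →
     proj₁ t w ≡ proj₁ s w)

Move : (T : PreTrinity) → State T → State T → Set
Move T s t = ∃ λ Δ → MoveBy T Δ s t

Recurrent : (T : PreTrinity) → State T → Set
Recurrent T s = TransClosure (Move T) s s

SameComponent : (T : PreTrinity) → State T → State T → Set
SameComponent T = Star (SymClosure (Move T))

InCyclicComponent : (T : PreTrinity) → State T → Set
InCyclicComponent T s = ∃ λ r → SameComponent T s r × Recurrent T r

Run : (T : PreTrinity) → State T → List (Black T) → State T → Set
Run T s []       u = s ≡ u
Run T s (Δ ∷ Δs) u = Σ (State T) λ t → MoveBy T Δ s t × Run T t Δs u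

module Submission where

open import Defs
open import Data.Product using (∃; _×_)
open import Data.List using (List; allFin)
open import Data.List.Relation.Binary.Permutation.Propositional using (_↭_)

open import Data.Nat using (ℕ; zero; suc; _+_)
open import Data.Nat.Properties using (n<1+n; +-suc; m≤n⇒∃[o]m+o≡n)
open import Data.Fin using (Fin; toℕ; _≟_)
open import Data.Fin.Properties using (pigeonhole)
open import Data.Fin.Permutation using (_⟨$⟩ʳ_; _⟨$⟩ˡ_; inverseˡ; inverseʳ)
open import Data.Product using (Σ; _,_; proj₁)
open import Data.Sum using (_⊎_; inj₁; inj₂)
open import Data.List using ([]; _∷_; _++_; [_])
open import Data.Empty using (⊥-elim)
open import Function.Bundles using (mk⇔)
open import Relation.Nullary using (¬_; Dec; yes; no)
open import Relation.Nullary.Decidable using (from-yes; map′; ¬?; _×-dec_; _⊎-dec_; _→-dec_)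
open import Relation.Binary.PropositionalEquality
  using (_≡_; _≢_; _≗_; refl; sym; trans; cong; subst)
open import Data.List.Membership.Propositional using (_∈_; _∉_)
open import Data.List.Membership.Propositional.Properties using (∈-++⁺ˡ; ∈-++⁺ʳ; ∈-++⁻; ∈-allFin)
import Data.List.Membership.DecPropositional as DecMembership
open import Data.List.Relation.Binary.Subset.Propositional using (_⊆_)
open import Data.List.Relation.Unary.Any using (here; there)
open import Data.List.Relation.Unary.All using ([])
open import Data.List.Relation.Unary.AllPairs using ([]; _∷_)
open import Data.List.Relation.Unary.Unique.Propositional using (Unique)
import Data.List.Relation.Unary.Unique.Propositional.Properties as Unique
open import Data.List.Membership.Propositional.Properties.WithK using (unique∧set⇒bag)
open import Data.List.Relation.Binary.BagAndSetEquality using (∼bag⇒↭)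
open import Relation.Binary.Construct.Closure.ReflexiveTransitive using (Star; ε; _◅_)
open import Relation.Binary.Construct.Closure.Symmetric using (fwd; bwd)
import Relation.Binary.Construct.Closure.Transitive as Plus

-- A state is recorded by the colour it gives to each white
-- triangle (a "colouring"); the clockwise move at a clockwise empty black
-- triangle Δ turns the three whites around Δ.  Around a fixed white triangle
-- its three black neighbours can only fire in a fixed cyclic order, and after
-- all three have fired once the white triangle has its original colour again.
-- From this we get the key combinatorial fact: the first occurrences of any
-- legal firing sequence form a legal firing sequence, and if every black
-- triangle occurs in the sequence then the first occurrences form an exact
-- cycle (every black triangle fires exactly once and the colouring returns).
-- Call a colouring "covering" if some legal firing sequence from it fires
-- every black triangle.  A recurrent state is covering (its first-occurrence
-- set is closed under adjacency, hence everything by connectivity), and being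
-- covering propagates along moves in both directions (backwards: exchange the
-- move to the front of an exact cycle).  So every state of a cyclic component
-- is covering, and its exact cycle is the required ordering.  Finally moves
-- on colourings are lifted back to moves of states (they preserve the
-- bijection between white triangles and vertices).

unique-complete⇒↭allFin : ∀ {n} {P : List (Fin n)} → Unique P → (∀ b → b ∈ P) → P ↭ allFin n
unique-complete⇒↭allFin {n} u complete =
  ∼bag⇒↭ (unique∧set⇒bag u (Unique.allFin⁺ n) (mk⇔ (λ _ → ∈-allFin _) (λ _ → complete _)))

∈-snoc⁻ : ∀ {A : Set} {x y : A} (P : List A) → x ∈ P ++ [ y ] → x ∈ P ⊎ x ≡ y
∈-snoc⁻ P m with ∈-++⁻ P m
... | inj₁ m′       = inj₁ m′
... | inj₂ (here e) = inj₂ e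

unique-snoc : ∀ {A : Set} {P : List A} {y : A} → Unique P → y ∉ P → Unique (P ++ [ y ])
unique-snoc u y∉P = Unique.++⁺ u ([] ∷ []) λ { (m , here refl) → y∉P m }

iter-suc : ∀ {A : Set} (f : A → A) i a → iter f (suc i) a ≡ iter f i (f a)
iter-suc f zero    a = refl
iter-suc f (suc i) a = cong f (iter-suc f i a)

iter-cancel : ∀ {A : Set} (f : A → A) → (∀ {x y} → f x ≡ f y → x ≡ y) →
  ∀ i d x → iter f i x ≡ iter f (i + d) x → x ≡ iter f d x
iter-cancel f inj zero    d x e = e
iter-cancel f inj (suc i) d x e = iter-cancel f inj i d x (inj e)

_≟ᶜ_ : (a b : Color) → Dec (a ≡ b)
red   ≟ᶜ red   = yes refl
green ≟ᶜ green = yes refl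
blue  ≟ᶜ blue  = yes refl
red   ≟ᶜ green = no λ ()
red   ≟ᶜ blue  = no λ ()
green ≟ᶜ red   = no λ ()
green ≟ᶜ blue  = no λ ()
blue  ≟ᶜ red   = no λ ()
blue  ≟ᶜ green = no λ ()

∀ᶜ? : {P : Color → Set} → (∀ c → Dec (P c)) → Dec (∀ c → P c)
∀ᶜ? P? = map′ (λ { (r , g , b) red → r ; (r , g , b) green → g ; (r , g , b) blue → b })
              (λ h → h red , h green , h blue)
              (P? red ×-dec P? green ×-dec P? blue)

next-injective : ∀ a b → next a ≡ next b → a ≡ b
next-injective = from-yes (∀ᶜ? λ a → ∀ᶜ? λ b → (next a ≟ᶜ next b) →-dec (a ≟ᶜ b))

prev-next : ∀ k → prev (next k) ≡ k
prev-next = from-yes (∀ᶜ? λ k → prev (next k) ≟ᶜ k)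

next-prev : ∀ k → next (prev k) ≡ k
next-prev = from-yes (∀ᶜ? λ k → next (prev k) ≟ᶜ k)

prev≡⇒≡next : ∀ {k j} → prev k ≡ j → k ≡ next j
prev≡⇒≡next {k} e = trans (sym (next-prev k)) (cong next e)

next≡⇒≡prev : ∀ {k j} → next k ≡ j → k ≡ prev j
next≡⇒≡prev {k} e = trans (sym (prev-next k)) (cong prev e)

-- The black neighbour of a white triangle w across the side opposite its
-- j-coloured corner fires only while w has colour next j, and moves it to
-- prev j = next (next j).  Starting from colour c₀ the three neighbours
-- therefore fire in the cyclic order prev c₀, c₀, next c₀, and
-- Fired c₀ c j says that neighbour j has fired once w has reached colour c
-- after at most two firings.
Fired : Color → Color → Color → Set
Fired c₀ c j = (c ≢ c₀ × j ≡ prev c₀) ⊎ (c ≡ prev c₀ × j ≡ c₀)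

fired? : ∀ c₀ c j → Dec (Fired c₀ c j)
fired? c₀ c j = (¬? (c ≟ᶜ c₀) ×-dec j ≟ᶜ prev c₀) ⊎-dec (c ≟ᶜ prev c₀ ×-dec j ≟ᶜ c₀)

fired-none : ∀ c₀ j → ¬ Fired c₀ c₀ j
fired-none = from-yes (∀ᶜ? λ c₀ → ∀ᶜ? λ j → ¬? (fired? c₀ c₀ j))

fired-pending : ∀ c₀ k → ¬ Fired c₀ (next k) k
fired-pending = from-yes (∀ᶜ? λ c₀ → ∀ᶜ? λ k → ¬? (fired? c₀ (next k) k))

fired-after : ∀ c₀ k j → k ≢ next c₀ → Fired c₀ (prev k) j → Fired c₀ (next k) j ⊎ j ≡ k
fired-after = from-yes (∀ᶜ? λ c₀ → ∀ᶜ? λ k → ∀ᶜ? λ j →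
  ¬? (k ≟ᶜ next c₀) →-dec fired? c₀ (prev k) j →-dec (fired? c₀ (next k) j ⊎-dec j ≟ᶜ k))

fired-before : ∀ c₀ k j → k ≢ next c₀ → Fired c₀ (next k) j ⊎ j ≡ k → Fired c₀ (prev k) j
fired-before = from-yes (∀ᶜ? λ c₀ → ∀ᶜ? λ k → ∀ᶜ? λ j →
  ¬? (k ≟ᶜ next c₀) →-dec (fired? c₀ (next k) j ⊎-dec j ≟ᶜ k) →-dec fired? c₀ (prev k) j)

fired-before-last : ∀ c₀ j → j ≢ next c₀ → Fired c₀ (next (next c₀)) j
fired-before-last = from-yes (∀ᶜ? λ c₀ → ∀ᶜ? λ j →
  ¬? (j ≟ᶜ next c₀) →-dec fired? c₀ (next (next c₀)) j)

module _ (T : PreTrinity) where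

  open DecMembership (_≟_ {n T}) using (_∈?_)

  white : Color → Black T → White T
  white k Δ = σ T k ⟨$⟩ʳ Δ

  black : Color → White T → Black T
  black k w = σ T k ⟨$⟩ˡ w

  black-white : ∀ k Δ → black k (white k Δ) ≡ Δ
  black-white k Δ = inverseˡ (σ T k)

  white-black : ∀ k w → white k (black k w) ≡ w
  white-black k w = inverseʳ (σ T k)

  white-injective : ∀ {k Δ Δ′} → white k Δ ≡ white k Δ′ → Δ ≡ Δ′
  white-injective {k} {Δ} {Δ′} e = trans (sym (black-white k Δ)) (trans (cong (black k) e) (black-white k Δ′))

  black-injective : ∀ {k w w′} → black k w ≡ black k w′ → w ≡ w′
  black-injective {k} {w} {w′} e = trans (sym (white-black k w)) (trans (cong (white k) e) (white-black k w′))

  black≡⇒white : ∀ {j w Δ} → black j w ≡ Δ → w ≡ white j Δ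
  black≡⇒white {j} {w} e = trans (sym (white-black j w)) (cong (white j) e)

  Colouring : Set
  Colouring = White T → Color

  -- the colouring-level form of ClockwiseEmpty
  record CwEmpty (f : Colouring) (Δ : Black T) : Set where
    constructor cwEmpty
    field empty : ∀ k → f (white k Δ) ≡ next k
  open CwEmpty

  cwEmpty-cong : ∀ {f f′ Δ} → f ≗ f′ → CwEmpty f Δ → CwEmpty f′ Δ
  cwEmpty-cong {Δ = Δ} f≗f′ c = cwEmpty λ k → trans (sym (f≗f′ (white k Δ))) (empty c k)

  cwEmpty-distinct : ∀ {f Δ a b} → CwEmpty f Δ → white a Δ ≡ white b Δ → a ≡ b
  cwEmpty-distinct {f} {Δ} {a} {b} c e =
    next-injective a b (trans (sym (empty c a)) (trans (cong f e) (empty c b)))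

  cwEmpty-disjoint : ∀ {f Δ Δ′ k j} → CwEmpty f Δ → CwEmpty f Δ′ → white k Δ ≡ white j Δ′ → Δ ≡ Δ′
  cwEmpty-disjoint {f} {k = k} {j} c c′ e
    with next-injective k j (trans (sym (empty c k)) (trans (cong f e) (empty c′ j)))
  ... | refl = white-injective e

  Around : Black T → White T → Set
  Around Δ w = (∃ λ k → w ≡ white k Δ) ⊎ (∀ k → w ≢ white k Δ)

  around : ∀ Δ w → Around Δ w
  around Δ w with w ≟ white red Δ | w ≟ white green Δ | w ≟ white blue Δ
  ... | yes e | _     | _     = inj₁ (red , e)
  ... | no _  | yes e | _     = inj₁ (green , e)
  ... | no _  | no _  | yes e = inj₁ (blue , e)
  ... | no r  | no g  | no b  = inj₂ λ { red → r ; green → g ; blue → b }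

  turn : Colouring → Black T → Colouring
  turn f Δ w with around Δ w
  ... | inj₁ (k , _) = prev k
  ... | inj₂ _       = f w

  turn-hit : ∀ {f Δ} → CwEmpty f Δ → ∀ k → turn f Δ (white k Δ) ≡ prev k
  turn-hit {f} {Δ} c k with around Δ (white k Δ)
  ... | inj₁ (k′ , e) = cong prev (sym (cwEmpty-distinct c e))
  ... | inj₂ away     = ⊥-elim (away k refl)

  turn-miss : ∀ {f Δ w} → (∀ k → w ≢ white k Δ) → turn f Δ w ≡ f w
  turn-miss {f} {Δ} {w} away with around Δ w
  ... | inj₁ (k , e) = ⊥-elim (away k e)
  ... | inj₂ _       = refl

  turn-cong : ∀ {f f′} Δ → f ≗ f′ → turn f Δ ≗ turn f′ Δ
  turn-cong Δ f≗f′ w with around Δ w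
  ... | inj₁ _ = refl
  ... | inj₂ _ = f≗f′ w

  cwEmpty-after-turn : ∀ {f X Y} → CwEmpty f X → CwEmpty f Y → X ≢ Y → CwEmpty (turn f Y) X
  cwEmpty-after-turn cX cY X≢Y =
    cwEmpty λ k → trans (turn-miss (λ j e → X≢Y (cwEmpty-disjoint cX cY e))) (empty cX k)

  turn-commute : ∀ {f X Y} → CwEmpty f X → CwEmpty f Y → X ≢ Y →
    turn (turn f X) Y ≗ turn (turn f Y) X
  turn-commute {f} {X} {Y} cX cY X≢Y w = commute (around X w) (around Y w)
    where
      commute : Around X w → Around Y w → turn (turn f X) Y w ≡ turn (turn f Y) X w
      commute (inj₁ (k , e)) (inj₁ (j , e′)) = ⊥-elim (X≢Y (cwEmpty-disjoint cX cY (trans (sym e) e′)))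
      commute (inj₁ (k , refl)) (inj₂ awayY) =
        trans (turn-miss awayY) (trans (turn-hit cX k) (sym (turn-hit (cwEmpty-after-turn cX cY X≢Y) k)))
      commute (inj₂ awayX) (inj₁ (j , refl)) =
        trans (turn-hit (cwEmpty-after-turn cY cX (λ e → X≢Y (sym e))) j)
              (sym (trans (turn-miss awayX) (turn-hit cY j)))
      commute (inj₂ awayX) (inj₂ awayY) =
        trans (turn-miss awayY) (trans (turn-miss awayX) (sym (trans (turn-miss awayX) (turn-miss awayY))))

  data Firing (f : Colouring) : List (Black T) → Colouring → Set where
    done : ∀ {g} → f ≗ g → Firing f [] g
    fire : ∀ {Δ L g} → CwEmpty f Δ → Firing (turn f Δ) L g → Firing f (Δ ∷ L) g

  firing-cong : ∀ {f f′ L g} → f ≗ f′ → Firing f L g → Firing f′ L g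
  firing-cong f≗f′ (done f≗g)      = done (λ w → trans (sym (f≗f′ w)) (f≗g w))
  firing-cong f≗f′ (fire {Δ} c r) = fire (cwEmpty-cong f≗f′ c) (firing-cong (turn-cong Δ f≗f′) r)

  firing-end : ∀ {f L g g′} → Firing f L g → g ≗ g′ → Firing f L g′
  firing-end (done f≗g) g≗g′ = done (λ w → trans (f≗g w) (g≗g′ w))
  firing-end (fire c r)  g≗g′ = fire c (firing-end r g≗g′)

  firing-snoc : ∀ {f L g Δ} → Firing f L g → CwEmpty g Δ → Firing f (L ++ [ Δ ]) (turn g Δ)
  firing-snoc {Δ = Δ} (done f≗g) c = fire (cwEmpty-cong (λ w → sym (f≗g w)) c) (done (turn-cong Δ f≗g))
  firing-snoc (fire c r) c′ = fire c (firing-snoc r c′)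

  firing-hoist : ∀ {f L e Δ} → Firing f L e → CwEmpty f Δ → Δ ∈ L →
    Σ (List (Black T)) λ L′ → Firing (turn f Δ) L′ e × (∀ {x} → x ∈ L → x ≢ Δ → x ∈ L′)
  firing-hoist {Δ = Δ} (fire {Δ′} c r) cΔ Δ∈L with Δ′ ≟ Δ
  ... | yes refl = _ , r , λ { (here refl) x≢Δ → ⊥-elim (x≢Δ refl) ; (there m) _ → m }
  ... | no Δ′≢Δ with Δ∈L
  ...   | here Δ≡Δ′ = ⊥-elim (Δ′≢Δ (sym Δ≡Δ′))
  ...   | there Δ∈L′ with firing-hoist r (cwEmpty-after-turn cΔ c (λ e → Δ′≢Δ (sym e))) Δ∈L′
  ...     | L″ , r″ , kept =
    Δ′ ∷ L″ ,
    fire (cwEmpty-after-turn c cΔ Δ′≢Δ) (firing-cong (turn-commute c cΔ Δ′≢Δ) r″) ,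
    λ { (here refl) _ → here refl ; (there m) x≢Δ → there (kept m x≢Δ) }

  -- The first occurrences P of a firing sequence run from f, reaching g,
  -- while the full sequence reached h.  Each white triangle w is then either
  -- closed (its three neighbours are in P, and g is back at f on w) or
  -- partial (g and h agree on w, and its neighbours in P are exactly those
  -- that have fired according to the colour h w).
  module FirstOccurrences (f : Colouring) where

    data WhiteInv (P : List (Black T)) (g h : Colouring) (w : White T) : Set where
      closed  : (∀ j → black j w ∈ P) → g w ≡ f w → WhiteInv P g h w
      partial : g w ≡ h w → (∀ j → black j w ∈ P → Fired (f w) (h w) j) →
                (∀ j → Fired (f w) (h w) j → black j w ∈ P) → WhiteInv P g h w

    Inv : List (Black T) → Colouring → Colouring → Set
    Inv P g h = ∀ w → WhiteInv P g h w

    whiteInv-cong : ∀ {P g g′ h h′ w} → g w ≡ g′ w → h w ≡ h′ w → WhiteInv P g h w → WhiteInv P g′ h′ w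
    whiteInv-cong eg eh (closed all e) = closed all (trans (sym eg) e)
    whiteInv-cong {w = w} eg eh (partial e in⇒fired fired⇒in) =
      partial (trans (sym eg) (trans e eh))
              (λ j m → subst (λ c → Fired (f w) c j) eh (in⇒fired j m))
              (λ j t → fired⇒in j (subst (λ c → Fired (f w) c j) (sym eh) t))

    whiteInv-extend : ∀ {P g h w Δ} → (∀ j → black j w ≢ Δ) → WhiteInv P g h w → WhiteInv (P ++ [ Δ ]) g h w
    whiteInv-extend away (closed all e) = closed (λ j → ∈-++⁺ˡ (all j)) e
    whiteInv-extend {P} away (partial e in⇒fired fired⇒in) =
      partial e (λ j m → in⇒fired j (old j (∈-snoc⁻ P m))) (λ j t → ∈-++⁺ˡ (fired⇒in j t))
      where
        old : ∀ j → _ ⊎ _ → black j _ ∈ P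
        old j (inj₁ m) = m
        old j (inj₂ e) = ⊥-elim (away j e)

    inv-start : Inv [] f f
    inv-start w = partial refl (λ j ()) (λ j t → ⊥-elim (fired-none (f w) j t))

    -- Firing again a triangle already in P keeps the invariant: its whites
    -- are closed, since in a partial one this neighbour would fire twice.
    inv-revisit : ∀ {P g h Δ} → Δ ∈ P → CwEmpty h Δ → Inv P g h → Inv P g (turn h Δ)
    inv-revisit {P} {g} {h} {Δ} Δ∈P c inv w = revisit w (inv w) (around Δ w)
      where
        revisit : ∀ w → WhiteInv P g h w → Around Δ w → WhiteInv P g (turn h Δ) w
        revisit w i (inj₂ away) = whiteInv-cong refl (sym (turn-miss away)) i
        revisit w (closed all e) (inj₁ _) = closed all e
        revisit w (partial _ in⇒fired _) (inj₁ (k , refl)) =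
          ⊥-elim (fired-pending (f (white k Δ)) k
            (subst (λ c → Fired _ c k) (empty c k) (in⇒fired k (subst (_∈ P) (sym (black-white k Δ)) Δ∈P))))

    -- Firing a new triangle Δ: it is clockwise empty at g too (its whites
    -- are partial), and appending it to P keeps the invariant.  A white of Δ
    -- becomes closed when Δ is its last neighbour to fire.
    inv-first : ∀ {P g h Δ} → Δ ∉ P → CwEmpty h Δ → Inv P g h →
      CwEmpty g Δ × Inv (P ++ [ Δ ]) (turn g Δ) (turn h Δ)
    inv-first {P} {g} {h} {Δ} Δ∉P c inv = cg , λ w → first w (inv w) (around Δ w)
      where
        not-closed : ∀ {k} {A : Set} → (∀ j → black j (white k Δ) ∈ P) → A
        not-closed {k} all = ⊥-elim (Δ∉P (subst (_∈ P) (black-white k Δ) (all k)))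

        colour : ∀ k → WhiteInv P g h (white k Δ) → g (white k Δ) ≡ next k
        colour k (closed all _)    = not-closed all
        colour k (partial e _ _) = trans e (empty c k)

        cg : CwEmpty g Δ
        cg = cwEmpty λ k → colour k (inv (white k Δ))

        first : ∀ w → WhiteInv P g h w → Around Δ w → WhiteInv (P ++ [ Δ ]) (turn g Δ) (turn h Δ) w
        first w i (inj₂ away) =
          whiteInv-cong (sym (turn-miss away)) (sym (turn-miss away))
                        (whiteInv-extend (λ j e → away j (black≡⇒white e)) i)
        first w (closed all _) (inj₁ (k , refl)) = not-closed all
        first w (partial e in⇒fired fired⇒in) (inj₁ (k , refl)) with k ≟ᶜ next (f (white k Δ))
        ... | yes last = closed all (trans (turn-hit cg k) (trans (cong prev last) (prev-next c₀)))
          where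
            c₀ = f (white k Δ)
            all : ∀ j → black j (white k Δ) ∈ P ++ [ Δ ]
            all j with j ≟ᶜ k
            ... | yes refl = ∈-++⁺ʳ P (here (black-white k Δ))
            ... | no j≢k   = ∈-++⁺ˡ (fired⇒in j (subst (λ c → Fired c₀ c j) (sym (empty c k))
                               (subst (λ x → Fired c₀ (next x) j) (sym last)
                                 (fired-before-last c₀ j (λ e → j≢k (trans e (sym last)))))))
        ... | no notLast = partial (trans (turn-hit cg k) (sym (turn-hit c k))) in⇒fired′ fired⇒in′
          where
            c₀ = f (white k Δ)
            earlier : ∀ {j} → Fired c₀ (h (white k Δ)) j → Fired c₀ (next k) j
            earlier = subst (λ c → Fired c₀ c _) (empty c k)
            in⇒fired′ : ∀ j → black j (white k Δ) ∈ P ++ [ Δ ] → Fired c₀ (turn h Δ (white k Δ)) j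
            in⇒fired′ j m = subst (λ c → Fired c₀ c j) (sym (turn-hit c k))
                              (fired-before c₀ k j notLast (now (∈-snoc⁻ P m)))
              where
                now : _ ⊎ _ → Fired c₀ (next k) j ⊎ j ≡ k
                now (inj₁ m′) = inj₁ (earlier (in⇒fired j m′))
                now (inj₂ e)  = inj₂ (sym (cwEmpty-distinct c (black≡⇒white e)))
            fired⇒in′ : ∀ j → Fired c₀ (turn h Δ (white k Δ)) j → black j (white k Δ) ∈ P ++ [ Δ ]
            fired⇒in′ j t with fired-after c₀ k j notLast (subst (λ c → Fired c₀ c j) (turn-hit c k) t)
            ... | inj₁ t′   = ∈-++⁺ˡ (fired⇒in j (subst (λ c → Fired c₀ c j) (sym (empty c k)) t′))
            ... | inj₂ refl = ∈-++⁺ʳ P (here (black-white j Δ))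

    record Extraction (h : Colouring) : Set where
      constructor extraction
      field
        P      : List (Black T)
        unique : Unique P
        g      : Colouring
        firing : Firing f P g
        inv    : Inv P g h

    extract : ∀ {h R e} (E : Extraction h) → Firing h R e →
      Σ (Extraction e) λ E′ → R ⊆ Extraction.P E′ × Extraction.P E ⊆ Extraction.P E′
    extract (extraction P u g fr inv) (done h≗e) =
      extraction P u g fr (λ w → whiteInv-cong refl (h≗e w) (inv w)) , (λ ()) , λ m → m
    extract (extraction P u g fr inv) (fire {Δ} c r) with Δ ∈? P
    ... | yes Δ∈P with extract (extraction P u g fr (inv-revisit Δ∈P c inv)) r
    ...   | E′ , R⊆ , P⊆ = E′ , (λ { (here refl) → P⊆ Δ∈P ; (there m) → R⊆ m }) , P⊆
    extract (extraction P u g fr inv) (fire {Δ} c r) | no Δ∉P with inv-first Δ∉P c inv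
    ...   | cg , inv′ with extract (extraction (P ++ [ Δ ]) (unique-snoc u Δ∉P) (turn g Δ) (firing-snoc fr cg) inv′) r
    ...     | E′ , R⊆ , P⊆ =
      E′ , (λ { (here refl) → P⊆ (∈-++⁺ʳ P (here refl)) ; (there m) → R⊆ m }) , λ m → P⊆ (∈-++⁺ˡ m)

    firstOccurrences : ∀ {L e} → Firing f L e → Σ (Extraction e) λ E → L ⊆ Extraction.P E
    firstOccurrences r with extract (extraction [] [] f (done (λ _ → refl)) inv-start) r
    ... | E , L⊆ , _ = E , L⊆

  open FirstOccurrences using (extraction; closed; partial; firstOccurrences)

  exact-cycle : ∀ {f L e} → Firing f L e → (∀ b → b ∈ L) →
    Σ (List (Black T)) λ P → Unique P × (∀ b → b ∈ P) × Firing f P f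
  exact-cycle {f} {e = e} r covers with firstOccurrences f r
  ... | extraction P u g fr inv , L⊆P = P , u , complete , firing-end fr back
    where
      complete : ∀ b → b ∈ P
      complete b = L⊆P (covers b)
      back : g ≗ f
      back w with inv w
      ... | closed _ g≡f = g≡f
      ... | partial _ in⇒fired _ =
        ⊥-elim (fired-pending (f w) (prev (e w))
          (subst (λ c → Fired (f w) c (prev (e w))) (sym (next-prev (e w))) (in⇒fired _ (complete _))))

  Covering : Colouring → Set
  Covering f = Σ (List (Black T)) λ L → Σ Colouring λ e → Firing f L e × (∀ b → b ∈ L)

  -- A firing cycle firing some triangle fires all of them: its first
  -- occurrences are closed under adjacency, since a white triangle with a
  -- fired neighbour cannot be partial when it has its original colour.
  cycle-covering : Connected T → ∀ {f L e Δ₀} → Firing f L e → e ≗ f → Δ₀ ∈ L → Covering f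
  cycle-covering (_ , connected) {f} {e = e} {Δ₀} r e≗f Δ₀∈L with firstOccurrences f r
  ... | extraction P _ g fr inv , L⊆P = P , g , fr , λ b → reach (connected Δ₀ b) (L⊆P Δ₀∈L)
    where
      neighbour : ∀ {x y} k k′ → white k x ≡ white k′ y → x ∈ P →
        FirstOccurrences.WhiteInv f P g e (white k x) → y ∈ P
      neighbour {x} {y} k k′ eq x∈P (closed all _) =
        subst (_∈ P) (trans (cong (black k′) eq) (black-white k′ y)) (all k′)
      neighbour {x} k k′ eq x∈P (partial _ in⇒fired _) =
        ⊥-elim (fired-none (f (white k x)) k (subst (λ c → Fired _ c k) (e≗f (white k x))
          (in⇒fired k (subst (_∈ P) (sym (black-white k x)) x∈P))))
      reach : ∀ {x y} → Star (Adj T) x y → x ∈ P → y ∈ P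
      reach ε x∈P = x∈P
      reach ((k , k′ , eq) ◅ path) x∈P = reach path (neighbour k k′ eq x∈P (inv _))

  ρ-injective : ∀ {k x y} → ρ T k x ≡ ρ T k y → x ≡ y
  ρ-injective e = white-injective (black-injective e)

  ρ-periodic : ∀ k x → Σ ℕ λ p → iter (ρ T k) (suc p) x ≡ x
  ρ-periodic k x with pigeonhole (n<1+n (n T)) (λ i → iter (ρ T k) (toℕ i) x)
  ... | i , j , i<j , eq with m≤n⇒∃[o]m+o≡n i<j
  ... | o , i+o≡j = o , sym (iter-cancel (ρ T k) ρ-injective (toℕ i) (suc o) x eq′)
    where
      eq′ : iter (ρ T k) (toℕ i) x ≡ iter (ρ T k) (toℕ i + suc o) x
      eq′ = trans eq (cong (λ m → iter (ρ T k) m x) (sym (trans (+-suc (toℕ i) o) i+o≡j)))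

  sameVertex-step : ∀ {j x y b} → ρ T j x ≡ y → SameVertex T j x b → SameVertex T j y b
  sameVertex-step {j} {x} {y} ρx≡y (zero , x≡b) with ρ-periodic j x
  ... | p , period = p , trans (cong (iter (ρ T j) p) (sym ρx≡y))
                           (trans (sym (iter-suc (ρ T j) p x)) (trans period x≡b))
  sameVertex-step {j} {x} ρx≡y (suc i , eq) =
    i , trans (cong (iter (ρ T j) i) (sym ρx≡y)) (trans (sym (iter-suc (ρ T j) i x)) eq)

  sameVertex-unstep : ∀ {j x y b} → ρ T j x ≡ y → SameVertex T j y b → SameVertex T j x b
  sameVertex-unstep {j} {x} ρx≡y (i , eq) =
    suc i , trans (iter-suc (ρ T j) i x) (trans (cong (iter (ρ T j) i) ρx≡y) eq)

  ρ-corner : ∀ j Δ → ρ T j (wcorner T (white (prev j) Δ) j) ≡ Δ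
  ρ-corner j Δ = trans (cong (black (prev j)) (white-black (next j) _)) (black-white (prev j) Δ)

  -- Moves send states to states: for colour j, the vertex formerly matched
  -- with white (prev j) Δ becomes matched with white (next j) Δ.
  turn-isState : ∀ {Δ} (s : State T) → CwEmpty (proj₁ s) Δ → IsState T (turn (proj₁ s) Δ)
  turn-isState {Δ} (f , isState) c j b with isState j b
  ... | w , (fw≡j , w∼b) , w-unique with w ≟ white (prev j) Δ
  ... | yes refl = white (next j) Δ , (colour , corner) , unique
    where
      colour : turn f Δ (white (next j) Δ) ≡ j
      colour = trans (turn-hit c (next j)) (prev-next j)
      corner : SameVertex T j (wcorner T (white (next j) Δ) j) b
      corner = subst (λ x → SameVertex T j x b) (sym (black-white (next j) Δ))
                     (sameVertex-step (ρ-corner j Δ) w∼b)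
      unique′ : ∀ w′ → turn f Δ w′ ≡ j → SameVertex T j (wcorner T w′ j) b → Around Δ w′ →
        w′ ≡ white (next j) Δ
      unique′ w′ t≡j _ (inj₁ (k , refl)) = cong (λ x → white x Δ) (prev≡⇒≡next (trans (sym (turn-hit c k)) t≡j))
      unique′ w′ t≡j w′∼b (inj₂ away) =
        ⊥-elim (away (prev j) (w-unique w′ (trans (sym (turn-miss away)) t≡j) w′∼b))
      unique : ∀ w′ → turn f Δ w′ ≡ j → SameVertex T j (wcorner T w′ j) b → w′ ≡ white (next j) Δ
      unique w′ t≡j w′∼b = unique′ w′ t≡j w′∼b (around Δ w′)
  ... | no w≢ = w , (trans (turn-miss away) fw≡j , w∼b) , unique
    where
      away : ∀ k → w ≢ white k Δ
      away k e = w≢ (trans e (cong (λ x → white x Δ)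
                   (next≡⇒≡prev (trans (sym (empty c k)) (trans (cong f (sym e)) fw≡j)))))
      unique′ : ∀ w′ → turn f Δ w′ ≡ j → SameVertex T j (wcorner T w′ j) b → Around Δ w′ → w′ ≡ w
      unique′ w′ t≡j w′∼b (inj₁ (k , refl)) with prev≡⇒≡next (trans (sym (turn-hit c k)) t≡j)
      ... | refl = ⊥-elim (w≢ (sym (w-unique (white (prev j) Δ) (trans (empty c (prev j)) (next-prev j))
                     (sameVertex-unstep (ρ-corner j Δ)
                       (subst (λ x → SameVertex T j x b) (black-white (next j) Δ) w′∼b)))))
      unique′ w′ t≡j w′∼b (inj₂ away′) = w-unique w′ (trans (sym (turn-miss away′)) t≡j) w′∼b
      unique : ∀ w′ → turn f Δ w′ ≡ j → SameVertex T j (wcorner T w′ j) b → w′ ≡ w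
      unique w′ t≡j w′∼b = unique′ w′ t≡j w′∼b (around Δ w′)

  moveBy⇒turn : ∀ {Δ s t} → MoveBy T Δ s t → CwEmpty (proj₁ s) Δ × turn (proj₁ s) Δ ≗ proj₁ t
  moveBy⇒turn {Δ} {s} {t} ((er , eb , eg) , tr , tb , tg , rest) = c , λ w → agree w (around Δ w)
    where
      c : CwEmpty (proj₁ s) Δ
      c = cwEmpty λ { red → er ; green → eg ; blue → eb }
      agree : ∀ w → Around Δ w → turn (proj₁ s) Δ w ≡ proj₁ t w
      agree w (inj₁ (red , refl))   = trans (turn-hit c red) (sym tr)
      agree w (inj₁ (green , refl)) = trans (turn-hit c green) (sym tg)
      agree w (inj₁ (blue , refl))  = trans (turn-hit c blue) (sym tb)
      agree w (inj₂ away) = trans (turn-miss away) (sym (rest w (away red) (away blue) (away green)))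

  turn⇒moveBy : ∀ {Δ s t} → CwEmpty (proj₁ s) Δ → turn (proj₁ s) Δ ≗ proj₁ t → MoveBy T Δ s t
  turn⇒moveBy c turn≗t =
    (empty c red , empty c blue , empty c green) ,
    trans (sym (turn≗t _)) (turn-hit c red) , trans (sym (turn≗t _)) (turn-hit c blue) ,
    trans (sym (turn≗t _)) (turn-hit c green) ,
    λ w r b g → trans (sym (turn≗t w)) (turn-miss (λ { red → r ; green → g ; blue → b }))

  covering-forward : ∀ {Δ s t} → MoveBy T Δ s t → Covering (proj₁ t) → Covering (proj₁ s)
  covering-forward {Δ} {s} {t} move (L , e , r , covers) with moveBy⇒turn {Δ} {s} {t} move
  ... | c , turn≗t = Δ ∷ L , e , fire c (firing-cong (λ w → sym (turn≗t w)) r) , λ b → there (covers b)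

  -- Backwards along a move t → s: shorten the covering sequence of t to an
  -- exact cycle, fire Δ first, and close the cycle by firing Δ again.
  covering-backward : ∀ {Δ t s} → MoveBy T Δ t s → Covering (proj₁ t) → Covering (proj₁ s)
  covering-backward {Δ} {t} {s} move (L , e , r , covers) with moveBy⇒turn {Δ} {t} {s} move
  ... | c , turn≗s with exact-cycle r covers
  ...   | P , _ , complete , cycle with firing-hoist cycle c (complete Δ)
  ...     | L′ , r′ , kept = L′ ++ [ Δ ] , turn (proj₁ t) Δ , firing-snoc (firing-cong turn≗s r′) c , covers′
    where
      covers′ : ∀ b → b ∈ L′ ++ [ Δ ]
      covers′ b with b ≟ Δ
      ... | yes refl = ∈-++⁺ʳ L′ (here refl)
      ... | no b≢Δ   = ∈-++⁺ˡ (kept (complete b) b≢Δ)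

  covering-in-component : ∀ {s r} → SameComponent T s r → Covering (proj₁ r) → Covering (proj₁ s)
  covering-in-component ε covering = covering
  covering-in-component {s} (_◅_ {j = t} (fwd (Δ , move)) path) covering =
    covering-forward {Δ} {s} {t} move (covering-in-component path covering)
  covering-in-component {s} (_◅_ {j = t} (bwd (Δ , move)) path) covering =
    covering-backward {Δ} {t} {s} move (covering-in-component path covering)

  moves⇒firing : ∀ {s t} → Plus.TransClosure (Move T) s t →
    Σ (Black T) λ Δ → Σ (List (Black T)) λ L → Firing (proj₁ s) (Δ ∷ L) (proj₁ t)
  moves⇒firing {s} {t} Plus.[ Δ , move ] with moveBy⇒turn {Δ} {s} {t} move
  ... | c , turn≗t = Δ , [] , fire c (done turn≗t)
  moves⇒firing {s} (Plus._∷_ {y = u} (Δ , move) moves) with moveBy⇒turn {Δ} {s} {u} move | moves⇒firing moves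
  ... | c , turn≗u | Δ′ , L , r = Δ , Δ′ ∷ L , fire c (firing-cong (λ w → sym (turn≗u w)) r)

  firing⇒run : (s u : State T) → ∀ {Δ L g} → Firing (proj₁ s) (Δ ∷ L) g → g ≗ proj₁ u → Run T s (Δ ∷ L) u
  firing⇒run s u {Δ} (fire c (done turn≗g)) g≗u =
    u , turn⇒moveBy {Δ} {s} {u} c (λ w → trans (turn≗g w) (g≗u w)) , refl
  firing⇒run s u {Δ} (fire c r@(fire _ _)) g≗u =
    t , turn⇒moveBy {Δ} {s} {t} c (λ _ → refl) , firing⇒run t u r g≗u
    where
      t : State T
      t = turn (proj₁ s) Δ , turn-isState s c

  cycle⇒run : (s : State T) → ∀ {P} → Firing (proj₁ s) P (proj₁ s) → Run T s P s
  cycle⇒run s {[]}    _ = refl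
  cycle⇒run s {_ ∷ _} r = firing⇒run s s r (λ _ → refl)

theorem5p9 : (T : PreTrinity) → Toric T → Irreducible T →
    (s : State T) → InCyclicComponent T s →
    ∃ λ (L : List (Black T)) → (L ↭ allFin (n T)) × Run T s L s
theorem5p9 T (connected , _) _ s (r , s∼r , r-recurrent) with moves⇒firing T r-recurrent
... | _ , _ , r-cycle with covering-in-component T s∼r (cycle-covering T connected r-cycle (λ _ → refl) (here refl))
... | _ , _ , s-covering , covers with exact-cycle T s-covering covers
... | P , unique , complete , s-cycle = P , unique-complete⇒↭allFin unique complete , cycle⇒run T s s-cycle
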